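{- Let $V=C\cup T$ be a partition of the variables of a MIN-$k$CSP instance ($k$ a constant) with $|T|\ge k$ and $|C|\ge|T|$, let $z\in D^V$, and for $y\in D^T$ and $K\in\binom{T}{k}$ let $$q_K(y)=\sum_{j=1}^k\sum_{J\in\binom{K}{j}}\sum_{L\in\binom{C}{k-j}}p_{J\cup L}(R_{Ty}(z))\binom{|T|-j}{k-j}^{ -1},$$ where $R_{Ty}(z)$ equals $y$ on $T$ and $z$ on $C$. Then $0\le q_K(y)\le O\!\left(\left(\frac{|C|}{|T|}\right)^{k-1}\right)$, where the constant in the $O(\cdot)$ depends only on $k$.
   Context: A MIN-$k$CSP instance: a set $V$ of variables with values in a finite domain $D$, cost functions $p_I:D^V\to[0,1]$ for $I\in\binom{V}{k}$ (the $k$-element subsets of $V$), $p_I(x)$ depending only on $x_u$ for $u\in I$. For a set $S$, $\binom{S}{m}$ denotes its $m$-element subsets.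
   Formalization: The cost functions $p_I$ take rational values in $[0,1]$ rather than real ones. -}

module Defs where

open import Data.Nat as ℕ using (ℕ; zero; suc; _∸_)
open import Data.Nat.Combinatorics using (_C_)
open import Data.Integer using (+_)
open import Data.Rational using (ℚ; 0ℚ; 1ℚ; _+_; _*_; _/_; _≤_)
open import Data.Bool using (Bool; true; false; if_then_else_)
open import Data.Fin using (Fin)
open import Data.Fin.Subset using (Subset; _∈_; _⊆_; ∁; _∪_; ∣_∣; inside; outside)
open import Data.Fin.Subset.Properties using (_⊆?_; _∈?_)
open import Data.List using (List; []; _∷_; map; filter; foldr; concatMap; upTo)
open import Data.Vec using (_∷_; [])
open import Relation.Nullary using (does)
open import Relation.Binary.PropositionalEquality using (_≡_)
open import Relation.Nullary.Decidable using (_×-dec_)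

allSubsets : ∀ n → List (Subset n)
allSubsets zero    = [] ∷ []
allSubsets (suc n) = concatMap (λ s → (outside ∷ s) ∷ (inside ∷ s) ∷ []) (allSubsets n)

subsetsOfSize : ∀ {n} → Subset n → ℕ → List (Subset n)
subsetsOfSize S m = filter (λ J → J ⊆? S ×-dec (∣ J ∣ ℕ.≟ m)) (allSubsets _)

sumℚ : List ℚ → ℚ
sumℚ = foldr _+_ 0ℚ

fromℕ : ℕ → ℚ
fromℕ m = (+ m) / 1

-- reciprocal of a natural number (convention 1/0 := 0; never used at 0 below
-- since |T| ≥ k makes all binomials (|T|-j choose k-j) positive)
recipℕ : ℕ → ℚ
recipℕ zero    = 0ℚ
recipℕ (suc m) = (+ 1) / suc m

_^ℚ_ : ℚ → ℕ → ℚ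
x ^ℚ zero  = 1ℚ
x ^ℚ suc m = x * (x ^ℚ m)

record MinCSP (k n : ℕ) (D : Set) : Set₁ where
  field
    p       : Subset n → (Fin n → D) → ℚ
    p-nonneg : ∀ I → ∣ I ∣ ≡ k → ∀ x → 0ℚ ≤ p I x
    p-le1    : ∀ I → ∣ I ∣ ≡ k → ∀ x → p I x ≤ 1ℚ
    p-local  : ∀ I → ∣ I ∣ ≡ k → ∀ x x′ → (∀ u → u ∈ I → x u ≡ x′ u) → p I x ≡ p I x′

R : ∀ {n} {D : Set} → Subset n → (Fin n → D) → (Fin n → D) → (Fin n → D)
R T y z u = if does (u ∈? T) then y u else z u

q : ∀ {k n} {D : Set} → MinCSP k n D → (T : Subset n) → (z : Fin n → D)
    → (K : Subset n) → (y : Fin n → D) → ℚ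
q {k} inst T z K y =
  sumℚ (map (λ i → let j = suc i in
    sumℚ (map (λ J →
      sumℚ (map (λ L → MinCSP.p inst (J ∪ L) (R T y z) * recipℕ ((∣ T ∣ ∸ j) C (k ∸ j)))
                (subsetsOfSize (∁ T) (k ∸ j))))
      (subsetsOfSize K j)))
    (upTo k))

-- For fixed j and J ⊆ K, the sum over L has at most binom(|C|, k-j) ≤ |C|^(k-j) terms, each a
-- cost in [0,1] times 1 / binom(|T|-j, k-j). Writing |T| = k + m, we have |T| ≤ k(m+1) and
-- binom(m+k-j, k-j) ≥ (m+1)^(k-j) / (k-j)!, so the sum over L is at most
-- k^k k! (|C|/|T|)^(k-j) ≤ k^k k! (|C|/|T|)^(k-1), the last step by |C| ≥ |T|.
-- There are at most k · k^k pairs (j, J).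
module Submission where

open import Defs
open import Data.Nat as ℕ using (ℕ; zero; suc; _≥_; _∸_; _!; z≤n; s≤s)
open import Data.Nat.Properties as ℕ
  using (+-assoc; +-comm; *-assoc; *-comm; *-identityˡ; *-identityʳ)
open import Data.Nat.Combinatorics using (_C_; nCk+nC[k+1]≡[n+1]C[k+1]; nC1≡n)
open import Data.Nat.Divisibility using (∣⇒≤; m≤n⇒m!∣n!)
open import Data.Nat.Tactic.RingSolver using (solve-∀)
open import Algebra.Properties.CommutativeSemigroup ℕ.*-commutativeSemigroup
  using (x∙yz≈y∙xz; x∙yz≈yx∙z)
open import Data.Integer as ℤ using (+_)
import Data.Integer.Properties as ℤ
open import Data.Rational using (ℚ; 0ℚ; 1ℚ; _≤_; _*_; _+_; toℚᵘ; nonNegative)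
import Data.Rational.Properties as ℚ
open import Data.Rational.Unnormalised as ℚᵘ using (mkℚᵘ; *≤*)
import Data.Rational.Unnormalised.Properties as ℚᵘ
open import Data.Bool using (true; false)
open import Data.Vec using (_∷_; []; here)
open import Data.Fin using (Fin)
open import Data.Fin.Subset using (Subset; ∣_∣; ∁; _⊆_; _∪_; inside; outside)
open import Data.Fin.Subset.Properties using (_⊆?_; drop-∷-⊆)
open import Data.List using (List; []; _∷_; map; length; filter; upTo; concatMap)
open import Data.List.Properties using (length-upTo)
open import Data.List.Relation.Unary.Any using (here; there)
open import Data.List.Membership.Propositional using (_∈_)
open import Data.List.Membership.Propositional.Properties using (∈-filter⁻; ∈-upTo⁻)
open import Data.Product using (∃; _×_; _,_; proj₁; proj₂)
open import Function using (_∘_)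
open import Relation.Nullary using (does)
open import Relation.Nullary.Decidable using (_×-dec_)
open import Relation.Binary.PropositionalEquality

-- Inequalities between rationals of the form u / v reduce to cross-multiplication in ℕ.

infix 4 _≐_/_

_≐_/_ : ℚ → ℕ → ℕ → Set
p ≐ u / v = ∃ λ d → suc d ≡ v × toℚᵘ p ℚᵘ.≃ mkℚᵘ (+ u) d

fromℕ≐ : ∀ u → fromℕ u ≐ u / 1
fromℕ≐ u = 0 , refl , ℚ.toℚᵘ-fromℚᵘ (mkℚᵘ (+ u) 0)

recipℕ≐ : ∀ {v} → 0 ℕ.< v → recipℕ v ≐ 1 / v
recipℕ≐ {suc v} _ = v , refl , ℚ.toℚᵘ-fromℚᵘ (mkℚᵘ (+ 1) v)

≐-* : ∀ {p q u v w x} → p ≐ u / v → q ≐ w / x → p * q ≐ u ℕ.* w / v ℕ.* x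
≐-* {p} {q} {u} {_} {w} (d , refl , p≃) (d′ , refl , q≃) =
  d′ ℕ.+ d ℕ.* suc d′ , refl ,
  ℚᵘ.≃-trans (ℚ.toℚᵘ-homo-* p q)
    (ℚᵘ.≃-trans (ℚᵘ.*-cong p≃ q≃)
      (ℚᵘ.≃-reflexive (cong (λ z → mkℚᵘ z _) (sym (ℤ.pos-* u w)))))

≐-+ : ∀ {p q u v w x} → p ≐ u / v → q ≐ w / x → p + q ≐ u ℕ.* x ℕ.+ w ℕ.* v / v ℕ.* x
≐-+ {p} {q} {u} {_} {w} (d , refl , p≃) (d′ , refl , q≃) =
  d′ ℕ.+ d ℕ.* suc d′ , refl ,
  ℚᵘ.≃-trans (ℚ.toℚᵘ-homo-+ p q)
    (ℚᵘ.≃-trans (ℚᵘ.+-cong p≃ q≃)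
      (ℚᵘ.≃-reflexive (cong (λ z → mkℚᵘ z _)
        (trans (cong₂ ℤ._+_ (sym (ℤ.pos-* u (suc d′))) (sym (ℤ.pos-* w (suc d))))
               (sym (ℤ.pos-+ (u ℕ.* suc d′) (w ℕ.* suc d)))))))

≐-^ : ∀ {p u v} → p ≐ u / v → ∀ e → p ^ℚ e ≐ u ℕ.^ e / v ℕ.^ e
≐-^ p≐ zero    = fromℕ≐ 1
≐-^ p≐ (suc e) = ≐-* p≐ (≐-^ p≐ e)

≐-≤ : ∀ {p q u v w x} → p ≐ u / v → q ≐ w / x → u ℕ.* x ℕ.≤ w ℕ.* v → p ≤ q
≐-≤ {u = u} {w = w} (d , refl , p≃) (d′ , refl , q≃) ux≤wv =
  ℚ.toℚᵘ-cancel-≤ (ℚᵘ.≤-trans (ℚᵘ.≤-reflexive p≃)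
    (ℚᵘ.≤-trans (*≤* (subst₂ ℤ._≤_ (ℤ.pos-* u (suc d′)) (ℤ.pos-* w (suc d)) (ℤ.+≤+ ux≤wv)))
      (ℚᵘ.≤-reflexive (ℚᵘ.≃-sym q≃))))

≐-nonneg : ∀ {p u v} → p ≐ u / v → 0ℚ ≤ p
≐-nonneg p≐ = ≐-≤ (fromℕ≐ 0) p≐ z≤n

≐-unique : ∀ {p q u v} → p ≐ u / v → q ≐ u / v → p ≡ q
≐-unique (d , refl , p≃) (_ , refl , q≃) = ℚ.toℚᵘ-injective (ℚᵘ.≃-trans p≃ (ℚᵘ.≃-sym q≃))

fromℕ-suc : ∀ n → fromℕ (suc n) ≡ 1ℚ + fromℕ n
fromℕ-suc n = ≐-unique (fromℕ≐ (suc n))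
  (subst (λ u → 1ℚ + fromℕ n ≐ suc u / 1) (*-identityʳ n) (≐-+ (fromℕ≐ 1) (fromℕ≐ n)))

fromℕ-mono-≤ : ∀ {u w} → u ℕ.≤ w → fromℕ u ≤ fromℕ w
fromℕ-mono-≤ {u} {w} u≤w =
  ≐-≤ (fromℕ≐ u) (fromℕ≐ w) (subst₂ ℕ._≤_ (sym (*-identityʳ u)) (sym (*-identityʳ w)) u≤w)

fromℕ-nonneg : ∀ u → 0ℚ ≤ fromℕ u
fromℕ-nonneg u = ≐-nonneg (fromℕ≐ u)

recipℕ-nonneg : ∀ v → 0ℚ ≤ recipℕ v
recipℕ-nonneg zero    = ℚ.≤-refl
recipℕ-nonneg (suc v) = ≐-nonneg (recipℕ≐ {suc v} (s≤s z≤n))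

*-nonneg : ∀ {p q} → 0ℚ ≤ p → 0ℚ ≤ q → 0ℚ ≤ p * q
*-nonneg {p} {q} p≥0 q≥0 =
  ℚ.nonNegative⁻¹ (p * q) {{ℚ.nonNeg*nonNeg⇒nonNeg p {{nonNegative p≥0}} q {{nonNegative q≥0}}}}

^ℚ-nonneg : ∀ {p} → 0ℚ ≤ p → ∀ e → 0ℚ ≤ p ^ℚ e
^ℚ-nonneg p≥0 zero    = ≐-nonneg (fromℕ≐ 1)
^ℚ-nonneg p≥0 (suc e) = *-nonneg p≥0 (^ℚ-nonneg p≥0 e)

≤1⇒*-≤ : ∀ {p q} → p ≤ 1ℚ → 0ℚ ≤ q → p * q ≤ q
≤1⇒*-≤ {p} {q} p≤1 q≥0 =
  ℚ.≤-trans (ℚ.*-monoʳ-≤-nonNeg q {{nonNegative q≥0}} p≤1) (ℚ.≤-reflexive (ℚ.*-identityˡ q))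

sumℚ-nonneg : ∀ {A : Set} (f : A → ℚ) (xs : List A) →
              (∀ x → x ∈ xs → 0ℚ ≤ f x) → 0ℚ ≤ sumℚ (map f xs)
sumℚ-nonneg f []       _  = ℚ.≤-refl
sumℚ-nonneg f (x ∷ xs) f≥0 =
  ℚ.+-mono-≤ (f≥0 x (here refl)) (sumℚ-nonneg f xs (λ y y∈ → f≥0 y (there y∈)))

sumℚ-≤-length* : ∀ {A : Set} (f : A → ℚ) (b : ℚ) (xs : List A) →
                 (∀ x → x ∈ xs → f x ≤ b) → sumℚ (map f xs) ≤ fromℕ (length xs) * b
sumℚ-≤-length* f b []       _   = ℚ.≤-reflexive (sym (ℚ.*-zeroˡ b))
sumℚ-≤-length* f b (x ∷ xs) f≤b = ℚ.≤-trans
  (ℚ.+-mono-≤ (f≤b x (here refl)) (sumℚ-≤-length* f b xs (λ y y∈ → f≤b y (there y∈))))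
  (ℚ.≤-reflexive (begin
     b + fromℕ (length xs) * b          ≡⟨ cong (_+ fromℕ (length xs) * b) (sym (ℚ.*-identityˡ b)) ⟩
     1ℚ * b + fromℕ (length xs) * b     ≡⟨ sym (ℚ.*-distribʳ-+ b 1ℚ (fromℕ (length xs))) ⟩
     (1ℚ + fromℕ (length xs)) * b       ≡⟨ cong (_* b) (sym (fromℕ-suc (length xs))) ⟩
     fromℕ (suc (length xs)) * b        ∎))
  where open ≡-Reasoning

sumℚ-≤-* : ∀ {A : Set} (f : A → ℚ) (b : ℚ) (xs : List A) {N} → 0ℚ ≤ b → length xs ℕ.≤ N →
           (∀ x → x ∈ xs → f x ≤ b) → sumℚ (map f xs) ≤ fromℕ N * b
sumℚ-≤-* f b xs b≥0 ∣xs∣≤N f≤b = ℚ.≤-trans (sumℚ-≤-length* f b xs f≤b)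
  (ℚ.*-monoʳ-≤-nonNeg b {{nonNegative b≥0}} (fromℕ-mono-≤ ∣xs∣≤N))

-- Binomial estimates

C≤^ : ∀ n k → n C k ℕ.≤ n ℕ.^ k
C≤^ zero    zero    = ℕ.≤-refl
C≤^ zero    (suc k) = z≤n
C≤^ (suc n) zero    = ℕ.≤-refl
C≤^ (suc n) (suc k) = begin
  suc n C suc k             ≡⟨ nCk+nC[k+1]≡[n+1]C[k+1] n k ⟨
  n C k ℕ.+ n C suc k       ≤⟨ ℕ.+-mono-≤ (C≤^ n k) (C≤^ n (suc k)) ⟩
  suc n ℕ.* n ℕ.^ k         ≤⟨ ℕ.*-monoʳ-≤ (suc n) (ℕ.^-monoˡ-≤ k (ℕ.n≤1+n n)) ⟩
  suc n ℕ.* suc n ℕ.^ k     ∎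
  where open ℕ.≤-Reasoning

[1+k]*[1+n]C[1+k]≡[1+n]*nCk : ∀ n k → suc k ℕ.* (suc n C suc k) ≡ suc n ℕ.* (n C k)
[1+k]*[1+n]C[1+k]≡[1+n]*nCk zero    zero    = refl
[1+k]*[1+n]C[1+k]≡[1+n]*nCk zero    (suc k) = ℕ.*-zeroʳ (suc (suc k))
[1+k]*[1+n]C[1+k]≡[1+n]*nCk (suc n) zero    =
  trans (*-identityˡ (suc (suc n) C 1)) (trans (nC1≡n (suc (suc n))) (sym (*-identityʳ (suc (suc n)))))
[1+k]*[1+n]C[1+k]≡[1+n]*nCk (suc n) (suc k) = begin
  suc (suc k) ℕ.* (suc (suc n) C suc (suc k))
    ≡⟨ cong (suc (suc k) ℕ.*_) (nCk+nC[k+1]≡[n+1]C[k+1] (suc n) (suc k)) ⟨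
  suc (suc k) ℕ.* (X ℕ.+ Y)
    ≡⟨ ℕ.*-distribˡ-+ (suc (suc k)) X Y ⟩
  (X ℕ.+ suc k ℕ.* X) ℕ.+ suc (suc k) ℕ.* Y
    ≡⟨ cong₂ (λ e f → (X ℕ.+ e) ℕ.+ f) ([1+k]*[1+n]C[1+k]≡[1+n]*nCk n k)
                                       ([1+k]*[1+n]C[1+k]≡[1+n]*nCk n (suc k)) ⟩
  (X ℕ.+ suc n ℕ.* (n C k)) ℕ.+ suc n ℕ.* (n C suc k)
    ≡⟨ +-assoc X _ _ ⟩
  X ℕ.+ (suc n ℕ.* (n C k) ℕ.+ suc n ℕ.* (n C suc k))
    ≡⟨ cong (X ℕ.+_) (ℕ.*-distribˡ-+ (suc n) (n C k) (n C suc k)) ⟨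
  X ℕ.+ suc n ℕ.* (n C k ℕ.+ n C suc k)
    ≡⟨ cong (λ e → X ℕ.+ suc n ℕ.* e) (nCk+nC[k+1]≡[n+1]C[k+1] n k) ⟩
  X ℕ.+ suc n ℕ.* X ∎
  where
  open ≡-Reasoning
  X = suc n C suc k
  Y = suc n C suc (suc k)

[1+m]^k≤k!*[m+k]Ck : ∀ m k → suc m ℕ.^ k ℕ.≤ k ! ℕ.* ((m ℕ.+ k) C k)
[1+m]^k≤k!*[m+k]Ck m zero    = ℕ.≤-refl
[1+m]^k≤k!*[m+k]Ck m (suc k) = begin
  suc m ℕ.* suc m ℕ.^ k
    ≤⟨ ℕ.*-mono-≤ (s≤s (ℕ.m≤m+n m k)) ([1+m]^k≤k!*[m+k]Ck m k) ⟩
  suc (m ℕ.+ k) ℕ.* (k ! ℕ.* ((m ℕ.+ k) C k))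
    ≡⟨ x∙yz≈y∙xz (suc (m ℕ.+ k)) (k !) _ ⟩
  k ! ℕ.* (suc (m ℕ.+ k) ℕ.* ((m ℕ.+ k) C k))
    ≡⟨ cong (k ! ℕ.*_) ([1+k]*[1+n]C[1+k]≡[1+n]*nCk (m ℕ.+ k) k) ⟨
  k ! ℕ.* (suc k ℕ.* (suc (m ℕ.+ k) C suc k))
    ≡⟨ x∙yz≈yx∙z (k !) (suc k) _ ⟩
  suc k ! ℕ.* (suc (m ℕ.+ k) C suc k)
    ≡⟨ cong (λ n → suc k ! ℕ.* (n C suc k)) (ℕ.+-suc m k) ⟨
  suc k ! ℕ.* ((m ℕ.+ suc k) C suc k) ∎
  where open ℕ.≤-Reasoning

0<[m+k]Ck : ∀ m k → 0 ℕ.< (m ℕ.+ k) C k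
0<[m+k]Ck m k with (m ℕ.+ k) C k | [1+m]^k≤k!*[m+k]Ck m k
... | zero  | 1+m^k≤0 = ℕ.<-≤-trans (ℕ.m^n>0 (suc m) k) (ℕ.≤-trans 1+m^k≤0 (ℕ.≤-reflexive (ℕ.*-zeroʳ (k !))))
... | suc _ | _       = s≤s z≤n

^-distribʳ-* : ∀ m n o → (m ℕ.* n) ℕ.^ o ≡ m ℕ.^ o ℕ.* n ℕ.^ o
^-distribʳ-* m n zero    = refl
^-distribʳ-* m n (suc o) =
  trans (cong (m ℕ.* n ℕ.*_) (^-distribʳ-* m n o)) (ℕ.[m*n]*[o*p]≡[m*o]*[n*p] m n _ _)

M : ℕ → ℕ
M k = k ℕ.^ k ℕ.* k !

[k+m]^a≤M[k]*[m+a]Ca : ∀ k m a → a ℕ.≤ suc k →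
                        (suc k ℕ.+ m) ℕ.^ a ℕ.≤ M (suc k) ℕ.* ((m ℕ.+ a) C a)
[k+m]^a≤M[k]*[m+a]Ca k m a a≤1+k = begin
  (suc k ℕ.+ m) ℕ.^ a                    ≤⟨ ℕ.^-monoˡ-≤ a k+m≤k*[1+m] ⟩
  (suc k ℕ.* suc m) ℕ.^ a                ≡⟨ ^-distribʳ-* (suc k) (suc m) a ⟩
  suc k ℕ.^ a ℕ.* suc m ℕ.^ a
    ≤⟨ ℕ.*-mono-≤ (ℕ.^-monoʳ-≤ (suc k) a≤1+k) ([1+m]^k≤k!*[m+k]Ck m a) ⟩
  suc k ℕ.^ suc k ℕ.* (a ! ℕ.* B)
    ≤⟨ ℕ.*-monoʳ-≤ (suc k ℕ.^ suc k) (ℕ.*-monoˡ-≤ B (∣⇒≤ {{suc k ℕ.!≢0}} (m≤n⇒m!∣n! a≤1+k))) ⟩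
  suc k ℕ.^ suc k ℕ.* (suc k ! ℕ.* B)    ≡⟨ *-assoc (suc k ℕ.^ suc k) (suc k !) B ⟨
  M (suc k) ℕ.* B                        ∎
  where
  open ℕ.≤-Reasoning
  B = (m ℕ.+ a) C a
  k+m≤k*[1+m] : suc k ℕ.+ m ℕ.≤ suc k ℕ.* suc m
  k+m≤k*[1+m] = ℕ.≤-trans (ℕ.+-monoʳ-≤ (suc k) (ℕ.m≤m*n m (suc k)))
                          (ℕ.≤-reflexive (*-comm (suc m) (suc k)))

-- Written for j = 1 + i, k = j + a and |T| = k + m.
binomial-ratio-bound : ∀ i a m c → suc (i ℕ.+ a) ℕ.+ m ℕ.≤ c →
  (c C a) ℕ.* (suc (i ℕ.+ a) ℕ.+ m) ℕ.^ (i ℕ.+ a)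
    ℕ.≤ M (suc (i ℕ.+ a)) ℕ.* c ℕ.^ (i ℕ.+ a) ℕ.* ((m ℕ.+ a) C a)
binomial-ratio-bound i a m c t≤c = begin
  (c C a) ℕ.* t ℕ.^ (i ℕ.+ a)                ≡⟨ cong ((c C a) ℕ.*_) (ℕ.^-distribˡ-+-* t i a) ⟩
  (c C a) ℕ.* (t ℕ.^ i ℕ.* t ℕ.^ a)
    ≤⟨ ℕ.*-mono-≤ (C≤^ c a) (ℕ.*-mono-≤ (ℕ.^-monoˡ-≤ i t≤c)
                    ([k+m]^a≤M[k]*[m+a]Ca (i ℕ.+ a) m a (ℕ.m≤n+m a (suc i)))) ⟩
  c ℕ.^ a ℕ.* (c ℕ.^ i ℕ.* (M k ℕ.* B))   ≡⟨ rearrange (c ℕ.^ a) (c ℕ.^ i) (M k) B ⟩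
  M k ℕ.* (c ℕ.^ i ℕ.* c ℕ.^ a) ℕ.* B     ≡⟨ cong (λ x → M k ℕ.* x ℕ.* B) (ℕ.^-distribˡ-+-* c i a) ⟨
  M k ℕ.* c ℕ.^ (i ℕ.+ a) ℕ.* B           ∎
  where
  open ℕ.≤-Reasoning
  k = suc (i ℕ.+ a)
  t = k ℕ.+ m
  B = (m ℕ.+ a) C a
  rearrange : ∀ x y z w → x ℕ.* (y ℕ.* (z ℕ.* w)) ≡ z ℕ.* (y ℕ.* x) ℕ.* w
  rearrange = solve-∀

weighted-count-bound′ : ∀ i a m c L → suc (i ℕ.+ a) ℕ.+ m ℕ.≤ c → L ℕ.≤ c C a →
  fromℕ L * recipℕ ((m ℕ.+ a) C a)
    ≤ fromℕ (M (suc (i ℕ.+ a))) * (fromℕ c * recipℕ (suc (i ℕ.+ a) ℕ.+ m)) ^ℚ (i ℕ.+ a)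
weighted-count-bound′ i a m c L t≤c L≤cCa =
  ≐-≤ (≐-* (fromℕ≐ L) (recipℕ≐ (0<[m+k]Ck m a)))
      (≐-* (fromℕ≐ (M k)) (≐-^ (≐-* (fromℕ≐ c) (recipℕ≐ (s≤s z≤n))) e))
      (begin
        L ℕ.* 1 ℕ.* (1 ℕ.* (1 ℕ.* t) ℕ.^ e)
          ≡⟨ cong₂ ℕ._*_ (*-identityʳ L) (trans (*-identityˡ _) (cong (ℕ._^ e) (*-identityˡ t))) ⟩
        L ℕ.* t ℕ.^ e                         ≤⟨ ℕ.*-monoˡ-≤ (t ℕ.^ e) L≤cCa ⟩
        (c C a) ℕ.* t ℕ.^ e                   ≤⟨ binomial-ratio-bound i a m c t≤c ⟩
        M k ℕ.* c ℕ.^ e ℕ.* B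
          ≡⟨ cong₂ (λ x y → M k ℕ.* x ℕ.^ e ℕ.* y) (*-identityʳ c) (*-identityˡ B) ⟨
        M k ℕ.* (c ℕ.* 1) ℕ.^ e ℕ.* (1 ℕ.* B) ∎)
  where
  open ℕ.≤-Reasoning
  k = suc (i ℕ.+ a)
  t = k ℕ.+ m
  e = i ℕ.+ a
  B = (m ℕ.+ a) C a

weighted-count-bound : ∀ {k t c i L} → suc i ℕ.≤ k → k ℕ.≤ t → t ℕ.≤ c → L ℕ.≤ c C (k ∸ suc i) →
  fromℕ L * recipℕ ((t ∸ suc i) C (k ∸ suc i)) ≤ fromℕ (M k) * (fromℕ c * recipℕ t) ^ℚ (k ∸ 1)
weighted-count-bound {c = c} {i} {L} 1+i≤k k≤t t≤c L≤cCk-j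
  with a , refl ← ℕ.m≤n⇒∃[o]m+o≡n 1+i≤k
  with m , refl ← ℕ.m≤n⇒∃[o]m+o≡n k≤t =
  subst₂ (λ n r → fromℕ L * recipℕ (n C r) ≤ rhs) (sym t-j≡m+a) (sym k-j≡a)
    (weighted-count-bound′ i a m c L t≤c (subst (λ r → L ℕ.≤ c C r) k-j≡a L≤cCk-j))
  where
  rhs = fromℕ (M (suc (i ℕ.+ a))) * (fromℕ c * recipℕ (suc (i ℕ.+ a) ℕ.+ m)) ^ℚ (i ℕ.+ a)
  k-j≡a : i ℕ.+ a ∸ i ≡ a
  k-j≡a = ℕ.m+n∸m≡n i a
  t-j≡m+a : i ℕ.+ a ℕ.+ m ∸ i ≡ m ℕ.+ a
  t-j≡m+a = trans (cong (_∸ i) (+-assoc i a m)) (trans (ℕ.m+n∸m≡n i (a ℕ.+ m)) (+-comm a m))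

-- Counting subsets

countOfSize : ∀ {n} → Subset n → ℕ → List (Subset n) → ℕ
countOfSize S m xs = length (filter (λ J → J ⊆? S ×-dec (∣ J ∣ ℕ.≟ m)) xs)

extensions : ∀ {n} → Subset n → List (Subset (suc n))
extensions s = (outside ∷ s) ∷ (inside ∷ s) ∷ []

countOfSize-outside : ∀ {n} (S : Subset n) m xs →
  countOfSize (outside ∷ S) m (concatMap extensions xs) ≡ countOfSize S m xs
countOfSize-outside S m [] = refl
countOfSize-outside S m (s ∷ xs) with does (s ⊆? S) | does (∣ s ∣ ℕ.≟ m)
... | true  | true  = cong suc (countOfSize-outside S m xs)
... | true  | false = countOfSize-outside S m xs
... | false | _     = countOfSize-outside S m xs

countOfSize-inside-zero : ∀ {n} (S : Subset n) xs →
  countOfSize (inside ∷ S) 0 (concatMap extensions xs) ≡ countOfSize S 0 xs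
countOfSize-inside-zero S [] = refl
countOfSize-inside-zero S (s ∷ xs) with does (s ⊆? S) in s⊆S | does (∣ s ∣ ℕ.≟ 0)
... | true  | true  rewrite s⊆S = cong suc (countOfSize-inside-zero S xs)
... | true  | false rewrite s⊆S = countOfSize-inside-zero S xs
... | false | _     rewrite s⊆S = countOfSize-inside-zero S xs

-- Pascal's rule: an m+1-subset of inside ∷ S either avoids the new point or contains it.
countOfSize-inside-suc : ∀ {n} (S : Subset n) m xs →
  countOfSize (inside ∷ S) (suc m) (concatMap extensions xs)
    ≡ countOfSize S (suc m) xs ℕ.+ countOfSize S m xs
countOfSize-inside-suc S m [] = refl
countOfSize-inside-suc S m (s ∷ xs)
  with does (s ⊆? S) in s⊆S | ∣ s ∣ ℕ.≡ᵇ suc m | ∣ s ∣ ℕ.≡ᵇ m in ∣s∣≡m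
... | true  | true  | true  rewrite s⊆S | ∣s∣≡m =
  cong suc (trans (cong suc (countOfSize-inside-suc S m xs)) (sym (ℕ.+-suc _ _)))
... | true  | true  | false rewrite s⊆S | ∣s∣≡m = cong suc (countOfSize-inside-suc S m xs)
... | true  | false | true  rewrite s⊆S | ∣s∣≡m =
  trans (cong suc (countOfSize-inside-suc S m xs)) (sym (ℕ.+-suc _ _))
... | true  | false | false rewrite s⊆S | ∣s∣≡m = countOfSize-inside-suc S m xs
... | false | _     | _     rewrite s⊆S = countOfSize-inside-suc S m xs

length-subsetsOfSize : ∀ {n} (S : Subset n) m → length (subsetsOfSize S m) ≡ ∣ S ∣ C m
length-subsetsOfSize [] zero    = refl
length-subsetsOfSize [] (suc m) = refl
length-subsetsOfSize {suc n} (outside ∷ S) m =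
  trans (countOfSize-outside S m (allSubsets n)) (length-subsetsOfSize S m)
length-subsetsOfSize {suc n} (inside ∷ S) zero =
  trans (countOfSize-inside-zero S (allSubsets n)) (length-subsetsOfSize S zero)
length-subsetsOfSize {suc n} (inside ∷ S) (suc m) = begin
  countOfSize (inside ∷ S) (suc m) (concatMap extensions (allSubsets n))
    ≡⟨ countOfSize-inside-suc S m (allSubsets n) ⟩
  length (subsetsOfSize S (suc m)) ℕ.+ length (subsetsOfSize S m)
    ≡⟨ cong₂ ℕ._+_ (length-subsetsOfSize S (suc m)) (length-subsetsOfSize S m) ⟩
  ∣ S ∣ C suc m ℕ.+ ∣ S ∣ C m
    ≡⟨ +-comm (∣ S ∣ C suc m) (∣ S ∣ C m) ⟩
  ∣ S ∣ C m ℕ.+ ∣ S ∣ C suc m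
    ≡⟨ nCk+nC[k+1]≡[n+1]C[k+1] ∣ S ∣ m ⟩
  suc ∣ S ∣ C suc m ∎
  where open ≡-Reasoning

∈-subsetsOfSize⁻ : ∀ {n} {S : Subset n} {m J} → J ∈ subsetsOfSize S m → J ⊆ S × ∣ J ∣ ≡ m
∈-subsetsOfSize⁻ {n} {S} {m} J∈ =
  proj₂ (∈-filter⁻ (λ J → J ⊆? S ×-dec (∣ J ∣ ℕ.≟ m)) {xs = allSubsets n} J∈)

∣p∪q∣≡∣p∣+∣q∣ : ∀ {n} (p q T : Subset n) → p ⊆ T → q ⊆ ∁ T → ∣ p ∪ q ∣ ≡ ∣ p ∣ ℕ.+ ∣ q ∣
∣p∪q∣≡∣p∣+∣q∣ [] [] [] _ _ = refl
∣p∪q∣≡∣p∣+∣q∣ (outside ∷ p) (outside ∷ q) (_ ∷ T) p⊆T q⊆∁T =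
  ∣p∪q∣≡∣p∣+∣q∣ p q T (drop-∷-⊆ p⊆T) (drop-∷-⊆ q⊆∁T)
∣p∪q∣≡∣p∣+∣q∣ (inside ∷ p) (outside ∷ q) (_ ∷ T) p⊆T q⊆∁T =
  cong suc (∣p∪q∣≡∣p∣+∣q∣ p q T (drop-∷-⊆ p⊆T) (drop-∷-⊆ q⊆∁T))
∣p∪q∣≡∣p∣+∣q∣ (outside ∷ p) (inside ∷ q) (_ ∷ T) p⊆T q⊆∁T =
  trans (cong suc (∣p∪q∣≡∣p∣+∣q∣ p q T (drop-∷-⊆ p⊆T) (drop-∷-⊆ q⊆∁T))) (sym (ℕ.+-suc ∣ p ∣ ∣ q ∣))
∣p∪q∣≡∣p∣+∣q∣ (inside ∷ p) (inside ∷ q) (outside ∷ T) p⊆T _ with () ← p⊆T here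
∣p∪q∣≡∣p∣+∣q∣ (inside ∷ p) (inside ∷ q) (inside ∷ T) _ q⊆∁T with () ← q⊆∁T here

constant : ℕ → ℚ
constant k = fromℕ k * (fromℕ (k ℕ.^ k) * fromℕ (M k))

module _ {k n d} (inst : MinCSP k n (Fin d)) (T : Subset n) (z y : Fin n → Fin d)
         {K : Subset n} (K∈ : K ∈ subsetsOfSize T k) where

  open MinCSP inst

  -- Index i ∈ upTo k stands for j = 1 + i in the definition of q_K.
  weight : ℕ → ℚ
  weight i = recipℕ ((∣ T ∣ ∸ suc i) C (k ∸ suc i))

  weight-nonneg : ∀ i → 0ℚ ≤ weight i
  weight-nonneg i = recipℕ-nonneg ((∣ T ∣ ∸ suc i) C (k ∸ suc i))

  term : ℕ → Subset n → Subset n → ℚ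
  term i J L = p (J ∪ L) (R T y z) * weight i

  sumOverL : ℕ → Subset n → ℚ
  sumOverL i J = sumℚ (map (term i J) (subsetsOfSize (∁ T) (k ∸ suc i)))

  sumOverJ : ℕ → ℚ
  sumOverJ i = sumℚ (map (sumOverL i) (subsetsOfSize K (suc i)))

  K⊆T : K ⊆ T
  K⊆T = proj₁ (∈-subsetsOfSize⁻ K∈)

  ∣J∪L∣≡k : ∀ {i J L} → i ∈ upTo k → J ∈ subsetsOfSize K (suc i) →
            L ∈ subsetsOfSize (∁ T) (k ∸ suc i) → ∣ J ∪ L ∣ ≡ k
  ∣J∪L∣≡k {i} {J} {L} i∈ J∈ L∈ = begin
    ∣ J ∪ L ∣                   ≡⟨ ∣p∪q∣≡∣p∣+∣q∣ J L T (K⊆T ∘ J⊆K) L⊆∁T ⟩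
    ∣ J ∣ ℕ.+ ∣ L ∣             ≡⟨ cong₂ ℕ._+_ ∣J∣≡1+i ∣L∣≡k-1-i ⟩
    suc i ℕ.+ (k ∸ suc i)       ≡⟨ ℕ.m+[n∸m]≡n (∈-upTo⁻ i∈) ⟩
    k                           ∎
    where
    open ≡-Reasoning
    J⊆K = proj₁ (∈-subsetsOfSize⁻ J∈)
    ∣J∣≡1+i = proj₂ (∈-subsetsOfSize⁻ J∈)
    L⊆∁T = proj₁ (∈-subsetsOfSize⁻ L∈)
    ∣L∣≡k-1-i = proj₂ (∈-subsetsOfSize⁻ L∈)

  q-nonneg : 0ℚ ≤ q inst T z K y
  q-nonneg =
    sumℚ-nonneg sumOverJ (upTo k) λ i i∈ →
      sumℚ-nonneg (sumOverL i) (subsetsOfSize K (suc i)) λ J J∈ →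
        sumℚ-nonneg (term i J) (subsetsOfSize (∁ T) (k ∸ suc i)) λ L L∈ →
          *-nonneg (p-nonneg (J ∪ L) (∣J∪L∣≡k i∈ J∈ L∈) (R T y z)) (weight-nonneg i)

  module _ (t≥k : ∣ T ∣ ≥ k) (c≥t : ∣ ∁ T ∣ ≥ ∣ T ∣) where

    ratio : ℚ
    ratio = fromℕ ∣ ∁ T ∣ * recipℕ ∣ T ∣

    innerBound : ℚ
    innerBound = fromℕ (M k) * ratio ^ℚ (k ∸ 1)

    innerBound-nonneg : 0ℚ ≤ innerBound
    innerBound-nonneg =
      *-nonneg (fromℕ-nonneg (M k))
        (^ℚ-nonneg (*-nonneg (fromℕ-nonneg ∣ ∁ T ∣) (recipℕ-nonneg ∣ T ∣)) (k ∸ 1))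

    sumOverL-≤ : ∀ {i J} → i ∈ upTo k → J ∈ subsetsOfSize K (suc i) → sumOverL i J ≤ innerBound
    sumOverL-≤ {i} {J} i∈ J∈ = ℚ.≤-trans
      (sumℚ-≤-length* (term i J) _ (subsetsOfSize (∁ T) (k ∸ suc i)) λ L L∈ →
        ≤1⇒*-≤ (p-le1 (J ∪ L) (∣J∪L∣≡k i∈ J∈ L∈) (R T y z)) (weight-nonneg i))
      (weighted-count-bound (∈-upTo⁻ i∈) t≥k c≥t
        (ℕ.≤-reflexive (length-subsetsOfSize (∁ T) (k ∸ suc i))))

    sumOverJ-≤ : ∀ {i} → i ∈ upTo k → sumOverJ i ≤ fromℕ (k ℕ.^ k) * innerBound
    sumOverJ-≤ {i} i∈ =
      sumℚ-≤-* (sumOverL i) _ (subsetsOfSize K (suc i)) innerBound-nonneg #J≤k^k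
        (λ J J∈ → sumOverL-≤ i∈ J∈)
      where
      instance
        k≢0 : ℕ.NonZero k
        k≢0 = ℕ.>-nonZero (ℕ.<-≤-trans (s≤s z≤n) (∈-upTo⁻ i∈))
      #J≤k^k : length (subsetsOfSize K (suc i)) ℕ.≤ k ℕ.^ k
      #J≤k^k = begin
        length (subsetsOfSize K (suc i)) ≡⟨ length-subsetsOfSize K (suc i) ⟩
        ∣ K ∣ C suc i                    ≡⟨ cong (_C suc i) (proj₂ (∈-subsetsOfSize⁻ K∈)) ⟩
        k C suc i                        ≤⟨ C≤^ k (suc i) ⟩
        k ℕ.^ suc i                      ≤⟨ ℕ.^-monoʳ-≤ k (∈-upTo⁻ i∈) ⟩
        k ℕ.^ k                          ∎
        where open ℕ.≤-Reasoning

    q-≤ : q inst T z K y ≤ constant k * ratio ^ℚ (k ∸ 1)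
    q-≤ = ℚ.≤-trans
      (sumℚ-≤-* sumOverJ _ (upTo k) (*-nonneg (fromℕ-nonneg (k ℕ.^ k)) innerBound-nonneg)
        (ℕ.≤-reflexive (length-upTo k)) (λ i i∈ → sumOverJ-≤ i∈))
      (ℚ.≤-reflexive (begin
        fromℕ k * (fromℕ (k ℕ.^ k) * (fromℕ (M k) * x))
          ≡⟨ cong (fromℕ k *_) (ℚ.*-assoc (fromℕ (k ℕ.^ k)) (fromℕ (M k)) x) ⟨
        fromℕ k * (fromℕ (k ℕ.^ k) * fromℕ (M k) * x)
          ≡⟨ ℚ.*-assoc (fromℕ k) _ x ⟨
        constant k * x ∎))
      where
      open ≡-Reasoning
      x = ratio ^ℚ (k ∸ 1)

lemma10 : ∀ (k : ℕ) → ∃ λ (c : ℚ) →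
    ∀ (n d : ℕ) (inst : MinCSP k n (Fin d)) (T : Subset n) →
    ∣ T ∣ ≥ k → ∣ ∁ T ∣ ≥ ∣ T ∣ →
    ∀ (z y : Fin n → Fin d) (K : Subset n) → K ∈ subsetsOfSize T k →
    (0ℚ ≤ q inst T z K y) ×
    (q inst T z K y ≤ c * ((fromℕ ∣ ∁ T ∣ * recipℕ ∣ T ∣) ^ℚ (k ∸ 1)))
lemma10 k = constant k , λ n d inst T t≥k c≥t z y K K∈ →
  q-nonneg inst T z y K∈ , q-≤ inst T z y K∈ t≥k c≥t
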